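{- Let $\mathbf B=(B,\le,0,1)$ be a finite linearly ordered scale and let $P:W\times W\to B$ be a $\mathbf B$-valued $\wedge$-preorder on a set $W$. Then for all $u,v\in W$, $$P^<(u,v)=\max\{b\wedge (P^<)_b(u,v): b\in B\}=\max\{b\wedge (P_b)^<(u,v): b\in B\},$$ where crisp relations are regarded as $\{0,1\}$-valued.
   Context: A $\mathbf B$-valued $\wedge$-preorder is a map $P:W\times W\to B$ with $P(u,u)=1$ and $P(u,v)\wedge P(v,w)\le P(u,w)$ for all $u,v,w$. Its strict counterpart is $P^<(u,v)=P(u,v)$ if $P(u,v)>P(v,u)$ and $P^<(u,v)=0$ otherwise. For $b\in B$: $P_b=\{(u,v):P(u,v)\ge b\}$; $(P^<)_b=\{(u,v):P^<(u,v)\ge b\}$; $(P_b)^<=\{(u,v):P(u,v)\ge b,\ P(v,u)<b\}$. -}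

module Defs where

open import Level using (Level; _⊔_) renaming (suc to lsuc)
open import Data.List using (List)
open import Data.List.Relation.Unary.Any using (Any)
open import Data.Product using (Σ; _×_; ∃)
open import Relation.Nullary using (¬_; yes; no)
open import Relation.Binary.Bundles using (DecTotalOrder)

record FiniteScale (c ℓ₁ ℓ₂ : Level) : Set (lsuc (c ⊔ ℓ₁ ⊔ ℓ₂)) where
  field
    order : DecTotalOrder c ℓ₁ ℓ₂
  open DecTotalOrder order public
  field
    𝟘 𝟙        : Carrier
    𝟘-least    : ∀ x → 𝟘 ≤ x
    𝟙-greatest : ∀ x → x ≤ 𝟙
    elements   : List Carrier
    complete   : ∀ x → Any (x ≈_) elements

  _∧_ : Carrier → Carrier → Carrier
  x ∧ y with x ≤? y
  ... | yes _ = x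
  ... | no  _ = y

  _<_ : Carrier → Carrier → Set ℓ₂
  x < y = ¬ (y ≤ x)

  IsMaxOf : Carrier → (Carrier → Carrier) → Set (c ⊔ ℓ₁ ⊔ ℓ₂)
  IsMaxOf x f = (∃ λ b → x ≈ f b) × (∀ b → f b ≤ x)

module _ {c ℓ₁ ℓ₂ : Level} (𝐁 : FiniteScale c ℓ₁ ℓ₂) where
  open FiniteScale 𝐁

  record IsPreorderᴮ {w : Level} {W : Set w} (P : W → W → Carrier) : Set (w ⊔ ℓ₁ ⊔ ℓ₂) where
    field
      refl-𝟙 : ∀ u → P u u ≈ 𝟙
      trans-∧ : ∀ u v w → (P u v ∧ P v w) ≤ P u w

  module _ {w : Level} {W : Set w} (P : W → W → Carrier) where

    strict : W → W → Carrier
    strict u v with P u v ≤? P v u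
    ... | yes _ = 𝟘
    ... | no  _ = P u v

    -- crisp relations regarded as {0,1}-valued
    -- (P^<)_b (u,v) : 1 iff P^<(u,v) ≥ b
    strictCut : Carrier → W → W → Carrier
    strictCut b u v with b ≤? strict u v
    ... | yes _ = 𝟙
    ... | no  _ = 𝟘

    -- (P_b)^< (u,v) : 1 iff P(u,v) ≥ b and P(v,u) < b
    cutStrict : Carrier → W → W → Carrier
    cutStrict b u v with b ≤? P u v | b ≤? P v u
    ... | yes _ | no _ = 𝟙
    ... | _     | _    = 𝟘

module Submission where

-- Both identities are facts about a single value x = P^<(u,v) and a crisp
-- ({0,1}-valued) family χ : B → B.
--
-- General fact (maxOf-indicator): if every b ∧ χ b lies below x and χ x = 1,
-- then x is the maximum of b ↦ b ∧ χ b, attained at b = x.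
--
-- For (P^<)_b the value χ b is 1 exactly when b ≤ P^<(u,v), so the general
-- fact applies directly.  For (P_b)^< we split on whether P(u,v) > P(v,u):
-- if so, P^<(u,v) = P(u,v), χ b = 1 forces b ≤ P(u,v), and χ(P(u,v)) = 1;
-- if not, P^<(u,v) = 0 and χ vanishes identically, since b ≤ P(u,v) ≤ P(v,u).

open import Defs
open import Level using (Level)
open import Data.Product using (_×_; _,_)
open import Data.Sum using (inj₁; inj₂)
open import Data.Empty using (⊥-elim)
open import Relation.Nullary using (¬_; yes; no)
open import Relation.Binary.PropositionalEquality using (_≡_; sym; subst) renaming (refl to ≡-refl)

module MeetLemmas {c ℓ₁ ℓ₂ : Level} (𝐁 : FiniteScale c ℓ₁ ℓ₂) where
  open FiniteScale 𝐁

  ∧-lowerˡ : ∀ x y → (x ∧ y) ≤ x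
  ∧-lowerˡ x y with x ≤? y
  ... | yes _ = refl
  ... | no x≰y with total x y
  ...   | inj₁ x≤y = ⊥-elim (x≰y x≤y)
  ...   | inj₂ y≤x = y≤x

  ∧-lowerʳ : ∀ x y → (x ∧ y) ≤ y
  ∧-lowerʳ x y with x ≤? y
  ... | yes x≤y = x≤y
  ... | no _    = refl

  ∧-greatest : ∀ {z} x y → z ≤ x → z ≤ y → z ≤ (x ∧ y)
  ∧-greatest x y z≤x z≤y with x ≤? y
  ... | yes _ = z≤x
  ... | no _  = z≤y

  ∧-identityʳ : ∀ x → x ≈ (x ∧ 𝟙)
  ∧-identityʳ x = antisym (∧-greatest x 𝟙 refl (𝟙-greatest x)) (∧-lowerˡ x 𝟙)

  ∧-zeroʳ : ∀ x y → (x ∧ 𝟘) ≤ y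
  ∧-zeroʳ x y = trans (∧-lowerʳ x 𝟘) (𝟘-least y)

  maxOf-indicator : ∀ x (χ : Carrier → Carrier) →
    (∀ b → (b ∧ χ b) ≤ x) → χ x ≡ 𝟙 → IsMaxOf x (λ b → b ∧ χ b)
  maxOf-indicator x χ bounded χx≡𝟙 =
    (x , subst (λ t → x ≈ (x ∧ t)) (sym χx≡𝟙) (∧-identityʳ x)) , bounded

  maxOf-𝟘 : (f : Carrier → Carrier) → (∀ b → f b ≤ 𝟘) → IsMaxOf 𝟘 f
  maxOf-𝟘 f bounded = (𝟘 , antisym (𝟘-least (f 𝟘)) (bounded 𝟘)) , bounded

module StrictCuts {c ℓ₁ ℓ₂ w : Level} (𝐁 : FiniteScale c ℓ₁ ℓ₂)
                  {W : Set w} (P : W → W → FiniteScale.Carrier 𝐁) (u v : W) where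
  open FiniteScale 𝐁
  open MeetLemmas 𝐁

  strictCut-bounded : ∀ b → (b ∧ strictCut 𝐁 P b u v) ≤ strict 𝐁 P u v
  strictCut-bounded b with b ≤? strict 𝐁 P u v
  ... | yes b≤s = trans (∧-lowerˡ b 𝟙) b≤s
  ... | no _    = ∧-zeroʳ b _

  strictCut-at-strict : strictCut 𝐁 P (strict 𝐁 P u v) u v ≡ 𝟙
  strictCut-at-strict with strict 𝐁 P u v ≤? strict 𝐁 P u v
  ... | yes _ = ≡-refl
  ... | no s≰s = ⊥-elim (s≰s refl)

  cutStrict-bounded : ∀ b → (b ∧ cutStrict 𝐁 P b u v) ≤ P u v
  cutStrict-bounded b with b ≤? P u v | b ≤? P v u
  ... | yes b≤p | no _ = trans (∧-lowerˡ b 𝟙) b≤p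
  ... | yes _   | yes _ = ∧-zeroʳ b _
  ... | no _    | yes _ = ∧-zeroʳ b _
  ... | no _    | no _  = ∧-zeroʳ b _

  cutStrict-vanishes : P u v ≤ P v u → ∀ b → (b ∧ cutStrict 𝐁 P b u v) ≤ 𝟘
  cutStrict-vanishes p≤q b with b ≤? P u v | b ≤? P v u
  ... | yes b≤p | no b≰q = ⊥-elim (b≰q (trans b≤p p≤q))
  ... | yes _   | yes _  = ∧-zeroʳ b 𝟘
  ... | no _    | yes _  = ∧-zeroʳ b 𝟘
  ... | no _    | no _   = ∧-zeroʳ b 𝟘

  cutStrict-at-P : ¬ (P u v ≤ P v u) → cutStrict 𝐁 P (P u v) u v ≡ 𝟙
  cutStrict-at-P p≰q with P u v ≤? P u v | P u v ≤? P v u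
  ... | yes _  | no _    = ≡-refl
  ... | yes _  | yes p≤q = ⊥-elim (p≰q p≤q)
  ... | no p≰p | _       = ⊥-elim (p≰p refl)

  strictCut-max : IsMaxOf (strict 𝐁 P u v) (λ b → b ∧ strictCut 𝐁 P b u v)
  strictCut-max = maxOf-indicator _ (λ b → strictCut 𝐁 P b u v)
                    strictCut-bounded strictCut-at-strict

  cutStrict-max : IsMaxOf (strict 𝐁 P u v) (λ b → b ∧ cutStrict 𝐁 P b u v)
  cutStrict-max with P u v ≤? P v u
  ... | yes p≤q = maxOf-𝟘 _ (cutStrict-vanishes p≤q)
  ... | no p≰q  = maxOf-indicator _ (λ b → cutStrict 𝐁 P b u v)
                    cutStrict-bounded (cutStrict-at-P p≰q)

proposition1 : {c ℓ₁ ℓ₂ w : Level} (𝐁 : FiniteScale c ℓ₁ ℓ₂) {W : Set w}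
    (P : W → W → FiniteScale.Carrier 𝐁) → IsPreorderᴮ 𝐁 P →
    ∀ u v →
    FiniteScale.IsMaxOf 𝐁 (strict 𝐁 P u v) (λ b → FiniteScale._∧_ 𝐁 b (strictCut 𝐁 P b u v))
    × FiniteScale.IsMaxOf 𝐁 (strict 𝐁 P u v) (λ b → FiniteScale._∧_ 𝐁 b (cutStrict 𝐁 P b u v))
proposition1 𝐁 P _ u v = StrictCuts.strictCut-max 𝐁 P u v , StrictCuts.cutStrict-max 𝐁 P u v
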